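{- For all integers $k\ge 2$ we have $D_k\subseteq D_{k+1}$.
   Context: For a positive integer $k$, let $S_k$ denote the set of all $k$-tuples $(n_1,\dots,n_k)$ of integers with $1\le n_1<n_2<\cdots<n_k$ satisfying $1=\frac{1}{n_1}+\cdots+\frac{1}{n_k}$. Let $D_k$ be the set of all integers $m$ such that $m=n_i$ for some $(n_1,\dots,n_k)\in S_k$ and some $1\le i\le k$, i.e. the set of denominators occurring in at least one $k$-term unit fraction decomposition of $1$ with distinct denominators. -}

module Defs where

open import Data.Nat using (ℕ; zero; suc; _<_; _≤_)
open import Data.Integer using (+_)
open import Data.Rational using (ℚ; _/_; 0ℚ; 1ℚ; _+_)
open import Data.Vec using (Vec; []; _∷_; foldr)
open import Data.Vec.Membership.Propositional using (_∈_)
open import Data.Product using (Σ; _×_)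
open import Data.Unit using (⊤)
open import Relation.Binary.PropositionalEquality using (_≡_)

-- 1/n as a rational; the value at n = 0 is irrelevant because
-- all denominators in S_k are required to be ≥ 1.
recip : ℕ → ℚ
recip zero    = 0ℚ
recip (suc n) = + 1 / suc n

sumRecip : ∀ {k} → Vec ℕ k → ℚ
sumRecip = foldr _ (λ n acc → recip n + acc) 0ℚ

data StrictlyIncreasing : ∀ {k} → Vec ℕ k → Set where
  []-inc  : StrictlyIncreasing []
  [-]-inc : ∀ {a} → StrictlyIncreasing (a ∷ [])
  ∷-inc   : ∀ {k a b} {v : Vec ℕ k} →
            a < b → StrictlyIncreasing (b ∷ v) → StrictlyIncreasing (a ∷ b ∷ v)

-- all entries ≥ 1: only n₁ ≥ 1 is required, as in the paper
FirstPositive : ∀ {k} → Vec ℕ k → Set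
FirstPositive []      = ⊤
FirstPositive (a ∷ _) = 1 ≤ a

InS : (k : ℕ) → Vec ℕ k → Set
InS k v = FirstPositive v × StrictlyIncreasing v × sumRecip v ≡ 1ℚ

InD : ℕ → ℕ → Set
InD k m = Σ (Vec ℕ k) (λ v → InS k v × m ∈ v)

module Submission where

-- Take a solution n₁ < ⋯ < x < N containing m and replace its last two terms by
-- three terms, all at least x, with the same reciprocal sum.  If m ≠ N, split N by
-- 1/N = 1/(N+1) + 1/(N(N+1)) and keep x.  If m = N, split x instead, by
-- 1/x = 1/(x+1) + 1/(x(x+1)), or, when N collides with one of these and x = c d is
-- composite, by 1/x = 1/(x+d) + 1/(x+xc).  In the remaining cases (x = 1, or x prime
-- with N ∈ {x+1, x(x+1)}) there is no such solution: clearing denominators,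
-- Σ 1/nᵢ = 1 says e_{k-1}(n) = Π nᵢ, and a modulus coprime to the smaller entries
-- (N if x = 1, x if N = x+1, and 3 or x² if N = x(x+1)) divides the right-hand side
-- but not the left.

open import Data.Integer.Base as ℤ using (+_)
open import Data.Integer.Properties using (pos-*; pos-+; +-injective)
open import Data.Nat.Base
  using (ℕ; zero; suc; _+_; _*_; _≤_; _<_; s≤s; z≤n; z<s; NonZero; >-nonZero; n>1⇒nonTrivial; nonTrivial⇒n>1)
open import Data.Nat.Properties
  using (_≟_; <-cmp; ≤-refl; ≤-trans; <⇒≤; <-trans; <-≤-trans; ≤-<-trans; <⇒≢; >⇒≢; ≤∧≢⇒<;
         n<1+n; m<m+n; m≤m+n; m<m*n; m≤m*n; +-comm; +-monoʳ-<; *-monoʳ-<; *-suc; *-comm;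
         *-identityˡ; *-identityʳ; m*n≢0)
open import Data.Nat.Divisibility
  using (_∣_; divides; _∣?_; ∣-refl; ∣-trans; ∣n⇒∣m*n; ∣m+n∣m⇒∣n; m∣m*n; n∣m*n;
         *-monoʳ-∣; *-cancelˡ-∣; >⇒∤)
open import Data.Nat.Divisibility.Core using (hasNonTrivialDivisor)
open import Data.Nat.Coprimality as Coprime using (Coprime; coprime-divisor; prime⇒coprime; 1-coprimeTo)
open import Data.Nat.Primality
  using (Prime; Composite; composite?; ¬composite⇒prime; prime⇒nonZero; prime⇒nonTrivial)
open import Data.Nat.Tactic.RingSolver using (solve-∀)
open import Data.Product using (Σ-syntax; ∃-syntax; _×_; _,_; proj₁; proj₂)
open import Data.Rational.Base using (_/_; 1ℚ; fromℚᵘ) renaming (_+_ to _+ℚ_)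
open import Data.Rational.Properties
  using (fromℚᵘ-cong; fromℚᵘ-injective; toℚᵘ-injective; toℚᵘ-homo-+; toℚᵘ-fromℚᵘ;
         +-identityʳ; +-0-commutativeMonoid)
  renaming (+-comm to +ℚ-comm)
open import Data.Rational.Unnormalised.Base as ℚᵘ using (mkℚᵘ; *≡*)
open import Data.Rational.Unnormalised.Properties using (≃-trans; ≃-sym; +-cong)
open import Data.Sum using (_⊎_; inj₁; inj₂; [_,_]′)
open import Data.Vec.Base using (Vec; []; _∷_; _++_; head; splitAt)
open import Data.Vec.Membership.Propositional using (_∈_)
open import Data.Vec.Relation.Unary.All as All using (All; []; _∷_)
open import Data.Vec.Relation.Unary.All.Properties using (++⁻)
open import Data.Vec.Relation.Unary.Any using (here; there)
import Data.Vec.Relation.Unary.Any.Properties as Any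
open import Data.Empty using (⊥-elim)
open import Function using (_∘_; const)
open import Relation.Nullary using (¬_; yes; no; contradiction)
open import Relation.Nullary.Decidable using (from-no)
open import Relation.Binary.Definitions using (tri<; tri≈; tri>)
open import Relation.Binary.PropositionalEquality
open import Algebra.Bundles using (CommutativeMonoid)
open import Algebra.Properties.CommutativeSemigroup
  (CommutativeMonoid.commutativeSemigroup +-0-commutativeMonoid) using (x∙yz≈y∙xz; x∙yz≈z∙xy)
open import Defs

fromℚᵘ-homo-+ : ∀ p q → fromℚᵘ p +ℚ fromℚᵘ q ≡ fromℚᵘ (p ℚᵘ.+ q)
fromℚᵘ-homo-+ p q = toℚᵘ-injective
  (≃-trans (toℚᵘ-homo-+ (fromℚᵘ p) (fromℚᵘ q))
  (≃-trans (+-cong (toℚᵘ-fromℚᵘ p) (toℚᵘ-fromℚᵘ q))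
           (≃-sym (toℚᵘ-fromℚᵘ (p ℚᵘ.+ q)))))

*≡*⇒/≡/ : ∀ a b c d .{{_ : NonZero b}} .{{_ : NonZero d}} →
          a * d ≡ c * b → + a / b ≡ + c / d
*≡*⇒/≡/ a (suc b) c (suc d) eq = fromℚᵘ-cong {mkℚᵘ (+ a) b} {mkℚᵘ (+ c) d}
  (*≡* (trans (sym (pos-* a (suc d))) (trans (cong +_ eq) (pos-* c (suc b)))))

/≡/⇒*≡* : ∀ a b c d .{{_ : NonZero b}} .{{_ : NonZero d}} →
          + a / b ≡ + c / d → a * d ≡ c * b
/≡/⇒*≡* a (suc b) c (suc d) eq with fromℚᵘ-injective {mkℚᵘ (+ a) b} {mkℚᵘ (+ c) d} eq
... | *≡* eq′ = +-injective (trans (pos-* a (suc d)) (trans eq′ (sym (pos-* c (suc b)))))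

/+/ : ∀ a b c d .{{_ : NonZero b}} .{{_ : NonZero d}} →
      + a / b +ℚ + c / d ≡ (+ (a * d + c * b) / (b * d)) {{m*n≢0 b d}}
/+/ a (suc b) c (suc d) = trans (fromℚᵘ-homo-+ (mkℚᵘ (+ a) b) (mkℚᵘ (+ c) d))
  (cong (λ n → n / (suc b * suc d))
    (trans (cong₂ ℤ._+_ (sym (pos-* a (suc d))) (sym (pos-* c (suc b))))
           (sym (pos-+ (a * suc d) (c * suc b)))))

recip+recip≡recip : ∀ {a b c} → 1 ≤ a → 1 ≤ b → 1 ≤ c →
                    c * (a + b) ≡ a * b → recip a +ℚ recip b ≡ recip c
recip+recip≡recip {suc a} {suc b} {suc c} _ _ _ eq =
  trans (/+/ 1 (suc a) 1 (suc b)) (*≡*⇒/≡/ (1 * suc b + 1 * suc a) (suc a * suc b) 1 (suc c) (begin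
    (1 * suc b + 1 * suc a) * suc c ≡⟨ rearrange (suc a) (suc b) (suc c) ⟩
    suc c * (suc a + suc b)         ≡⟨ eq ⟩
    suc a * suc b                   ≡⟨ sym (*-identityˡ _) ⟩
    1 * (suc a * suc b)             ∎))
  where
  open ≡-Reasoning
  rearrange : ∀ a b c → (1 * b + 1 * a) * c ≡ c * (a + b)
  rearrange = solve-∀

sumRecip-pair : ∀ a b → sumRecip (a ∷ b ∷ []) ≡ recip a +ℚ recip b
sumRecip-pair a b = cong (recip a +ℚ_) (+-identityʳ (recip b))

sumRecip-triple : ∀ a b c → sumRecip (a ∷ b ∷ c ∷ []) ≡ recip a +ℚ (recip b +ℚ recip c)
sumRecip-triple a b c = cong (recip a +ℚ_) (sumRecip-pair b c)

sumRecip-++-cong : ∀ {n k k′} (u : Vec ℕ n) {w : Vec ℕ k} {w′ : Vec ℕ k′} →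
                   sumRecip w ≡ sumRecip w′ → sumRecip (u ++ w) ≡ sumRecip (u ++ w′)
sumRecip-++-cong []      eq = eq
sumRecip-++-cong (a ∷ u) eq = cong (recip a +ℚ_) (sumRecip-++-cong u eq)

-- cofactorSum is the elementary symmetric polynomial of degree k − 1 in the k entries.

product : ∀ {k} → Vec ℕ k → ℕ
product []      = 1
product (a ∷ v) = a * product v

cofactorSum : ∀ {k} → Vec ℕ k → ℕ
cofactorSum []      = 0
cofactorSum (a ∷ v) = product v + a * cofactorSum v

product-nonZero : ∀ {k} {v : Vec ℕ k} → All (1 ≤_) v → NonZero (product v)
product-nonZero []                         = _
product-nonZero {v = a ∷ v} (1≤a ∷ 1≤v) =
  m*n≢0 a (product v) {{>-nonZero 1≤a}} {{product-nonZero 1≤v}}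

sumRecip≡cofactorSum/product : ∀ {k} {v : Vec ℕ k} (1≤v : All (1 ≤_) v) →
  sumRecip v ≡ (+ cofactorSum v / product v) {{product-nonZero 1≤v}}
sumRecip≡cofactorSum/product [] = refl
sumRecip≡cofactorSum/product {v = suc a ∷ v} (s≤s z≤n ∷ 1≤v) = begin
  recip (suc a) +ℚ sumRecip v
    ≡⟨ cong (recip (suc a) +ℚ_) (sumRecip≡cofactorSum/product 1≤v) ⟩
  + 1 / suc a +ℚ + cofactorSum v / product v
    ≡⟨ /+/ 1 (suc a) (cofactorSum v) (product v) ⟩
  + (1 * product v + cofactorSum v * suc a) / (suc a * product v)
    ≡⟨ cong (λ n → + n / (suc a * product v))
         (cong₂ _+_ (*-identityˡ (product v)) (*-comm (cofactorSum v) (suc a))) ⟩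
  + (product v + suc a * cofactorSum v) / (suc a * product v) ∎
  where
  open ≡-Reasoning
  instance
    _ = product-nonZero 1≤v
    _ = m*n≢0 (suc a) (product v)

cofactorSum≡product : ∀ {k} {v : Vec ℕ k} → All (1 ≤_) v → sumRecip v ≡ 1ℚ →
                      cofactorSum v ≡ product v
cofactorSum≡product {v = v} 1≤v sum≡1 = begin
  cofactorSum v     ≡⟨ sym (*-identityʳ (cofactorSum v)) ⟩
  cofactorSum v * 1 ≡⟨ /≡/⇒*≡* (cofactorSum v) (product v) 1 1 {{product-nonZero 1≤v}}
                         (trans (sym (sumRecip≡cofactorSum/product 1≤v)) sum≡1) ⟩
  1 * product v     ≡⟨ *-identityˡ (product v) ⟩
  product v         ∎
  where open ≡-Reasoning

product-pair : ∀ a b → product (a ∷ b ∷ []) ≡ a * b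
product-pair a b = cong (a *_) (*-identityʳ b)

cofactorSum-pair : ∀ a b → cofactorSum (a ∷ b ∷ []) ≡ a + b
cofactorSum-pair a b = normalise a b
  where
  normalise : ∀ a b → b * 1 + a * (1 + b * 0) ≡ a + b
  normalise = solve-∀

∣product-++ : ∀ {n k q} (u : Vec ℕ n) {w : Vec ℕ k} → q ∣ product w → q ∣ product (u ++ w)
∣product-++ []      q∣P = q∣P
∣product-++ (a ∷ u) q∣P = ∣n⇒∣m*n a (∣product-++ u q∣P)

∤cofactorSum-++ : ∀ {n k q} (u : Vec ℕ n) {w : Vec ℕ k} → All (Coprime q) u →
                  q ∣ product w → ¬ q ∣ cofactorSum w → ¬ q ∣ cofactorSum (u ++ w)
∤cofactorSum-++ []      []          _   q∤S      = q∤S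
∤cofactorSum-++ (a ∷ u) (q⊥a ∷ q⊥u) q∣P q∤S q∣S′ = ∤cofactorSum-++ u q⊥u q∣P q∤S
  (coprime-divisor q⊥a (∣m+n∣m⇒∣n q∣S′ (∣product-++ u q∣P)))

coprime-* : ∀ {m n o} → Coprime m n → Coprime o n → Coprime (m * o) n
coprime-* {m} m⊥n o⊥n {d} (d∣mo , d∣n) = o⊥n (coprime-divisor d⊥m d∣mo , d∣n)
  where
  d⊥m : Coprime d m
  d⊥m (c∣d , c∣m) = m⊥n (c∣m , ∣-trans c∣d d∣n)

increasing-tail : ∀ {k a} {v : Vec ℕ k} → StrictlyIncreasing (a ∷ v) → StrictlyIncreasing v
increasing-tail [-]-inc       = []-inc
increasing-tail (∷-inc _ inc) = inc

increasing-++⁻ʳ : ∀ {n k} (u : Vec ℕ n) {w : Vec ℕ k} → StrictlyIncreasing (u ++ w) → StrictlyIncreasing w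
increasing-++⁻ʳ []      inc = inc
increasing-++⁻ʳ (a ∷ u) inc = increasing-++⁻ʳ u (increasing-tail inc)

increasing⇒positive : ∀ {k} {v : Vec ℕ k} → FirstPositive v → StrictlyIncreasing v → All (1 ≤_) v
increasing⇒positive _   []-inc          = []
increasing⇒positive 1≤a [-]-inc         = 1≤a ∷ []
increasing⇒positive 1≤a (∷-inc a<b inc) = 1≤a ∷ increasing⇒positive (≤-trans 1≤a (<⇒≤ a<b)) inc

increasing⇒prefix< : ∀ {n k a} (u : Vec ℕ n) {w : Vec ℕ k} → StrictlyIncreasing (u ++ a ∷ w) → All (_< a) u
increasing⇒prefix< []          _                = []
increasing⇒prefix< (c ∷ [])    (∷-inc c<a _)    = c<a ∷ []
increasing⇒prefix< (c ∷ d ∷ u) (∷-inc c<d inc) with increasing⇒prefix< (d ∷ u) inc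
... | d<a ∷ u<a = <-trans c<d d<a ∷ d<a ∷ u<a

increasing-++-replace : ∀ {n k k′ a} (u : Vec ℕ n) {w : Vec ℕ k} {w′ : Vec ℕ (suc k′)} →
  StrictlyIncreasing (u ++ a ∷ w) → StrictlyIncreasing w′ → a ≤ head w′ → StrictlyIncreasing (u ++ w′)
increasing-++-replace []          _                            inc′ _   = inc′
increasing-++-replace (c ∷ [])    {w′ = _ ∷ _} (∷-inc c<a _)   inc′ a≤b = ∷-inc (<-≤-trans c<a a≤b) inc′
increasing-++-replace (c ∷ d ∷ u) (∷-inc c<d inc)              inc′ a≤b =
  ∷-inc c<d (increasing-++-replace (d ∷ u) inc inc′ a≤b)

firstPositive-++-replace : ∀ {n k k′ a} (u : Vec ℕ n) {w : Vec ℕ k} {w′ : Vec ℕ (suc k′)} →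
  FirstPositive (u ++ a ∷ w) → a ≤ head w′ → FirstPositive (u ++ w′)
firstPositive-++-replace []      {w′ = _ ∷ _} 1≤a a≤b = ≤-trans 1≤a a≤b
firstPositive-++-replace (c ∷ u)              1≤c _   = 1≤c

lastTwo-bounds : ∀ {n x N} (u : Vec ℕ n) → InS _ (u ++ x ∷ N ∷ []) → 1 ≤ x × x < N
lastTwo-bounds u (fp , inc , _) with proj₂ (++⁻ u (increasing⇒positive fp inc)) | increasing-++⁻ʳ u inc
... | 1≤x ∷ _ | ∷-inc x<N _ = 1≤x , x<N

-- Such a q divides the product of the entries of any solution ending in x, N but
-- not its cofactor sum, contradicting cofactorSum≡product.
record Obstruction (q x N : ℕ) : Set where
  field
    coprime : ∀ {e} → 1 ≤ e × e < x → Coprime q e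
    ∣x*N    : q ∣ x * N
    ∤x+N    : ¬ q ∣ x + N

obstructed : ∀ {n q x N} (u : Vec ℕ n) → InS _ (u ++ x ∷ N ∷ []) → ¬ Obstruction q x N
obstructed {q = q} {x} {N} u (fp , inc , sum≡1) o =
  q∤S (subst (q ∣_) (sym (cofactorSum≡product 1≤v sum≡1)) q∣P)
  where
  open Obstruction o
  1≤v : All (1 ≤_) (u ++ x ∷ N ∷ [])
  1≤v = increasing⇒positive fp inc
  q∣xN : q ∣ product (x ∷ N ∷ [])
  q∣xN = subst (q ∣_) (sym (product-pair x N)) ∣x*N
  q∣P : q ∣ product (u ++ x ∷ N ∷ [])
  q∣P = ∣product-++ u q∣xN
  q⊥u : All (Coprime q) u
  q⊥u = All.map coprime (All.zip (proj₁ (++⁻ u 1≤v) , increasing⇒prefix< u inc))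
  q∤S : ¬ q ∣ cofactorSum (u ++ x ∷ N ∷ [])
  q∤S = ∤cofactorSum-++ u q⊥u q∣xN (∤x+N ∘ subst (q ∣_) (cofactorSum-pair x N))

obstruction-one : ∀ {N} → 1 < N → Obstruction N 1 N
obstruction-one {N} 1<N = record
  { coprime = λ { (s≤s z≤n , s≤s ()) }
  ; ∣x*N    = n∣m*n 1
  ; ∤x+N    = λ N∣1+N → >⇒∤ 1<N (∣m+n∣m⇒∣n (subst (N ∣_) (+-comm 1 N) N∣1+N) ∣-refl)
  }

obstruction-prime-suc : ∀ {p} → Prime p → Obstruction p p (suc p)
obstruction-prime-suc {p} prime-p = record
  { coprime = λ (1≤e , e<p) → prime⇒coprime prime-p {{>-nonZero 1≤e}} e<p
  ; ∣x*N    = m∣m*n (suc p)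
  ; ∤x+N    = λ p∣2p+1 → >⇒∤ (nonTrivial⇒n>1 p {{prime⇒nonTrivial prime-p}})
                (∣m+n∣m⇒∣n (subst (p ∣_) (+-comm 1 p) (∣m+n∣m⇒∣n p∣2p+1 ∣-refl)) ∣-refl)
  }

obstruction-two-six : Obstruction 3 2 6
obstruction-two-six = record
  { coprime = λ { (s≤s z≤n , s≤s (s≤s z≤n)) → Coprime.sym (1-coprimeTo 3) }
  ; ∣x*N    = divides 4 refl
  ; ∤x+N    = from-no (3 ∣? 8)
  }

obstruction-prime-pronic : ∀ {p} → Prime p → p ≢ 2 → Obstruction (p * p) p (p * suc p)
obstruction-prime-pronic {p} prime-p p≢2 = record
  { coprime = λ (1≤e , e<p) → let p⊥e = prime⇒coprime prime-p {{>-nonZero 1≤e}} e<p in coprime-* p⊥e p⊥e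
  ; ∣x*N    = *-monoʳ-∣ p (m∣m*n (suc p))
  ; ∤x+N    = λ p²∣p[p+2] → >⇒∤ 2<p (∣m+n∣m⇒∣n (*-cancelˡ-∣ p {{prime⇒nonZero prime-p}}
                (subst (p * p ∣_) (factor p) p²∣p[p+2])) ∣-refl)
  }
  where
  2<p : 2 < p
  2<p = ≤∧≢⇒< (nonTrivial⇒n>1 p {{prime⇒nonTrivial prime-p}}) (p≢2 ∘ sym)
  factor : ∀ p → p + p * suc p ≡ p * (p + 2)
  factor = solve-∀

no-solution-ending-prime : ∀ {n p N} (u : Vec ℕ n) → Prime p → N ≡ suc p ⊎ N ≡ p * suc p →
                           ¬ InS _ (u ++ p ∷ N ∷ [])
no-solution-ending-prime u prime-p (inj₁ refl) sol = obstructed u sol (obstruction-prime-suc prime-p)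
no-solution-ending-prime {p = p} u prime-p (inj₂ refl) sol with p ≟ 2
... | yes refl = obstructed u sol obstruction-two-six
... | no p≢2   = obstructed u sol (obstruction-prime-pronic prime-p p≢2)

record PairSplit (x : ℕ) : Set where
  field
    a b       : ℕ
    x<a       : x < a
    a<b       : a < b
    recip-sum : recip a +ℚ recip b ≡ recip x

pairSplit-suc : ∀ {x} → 1 < x → PairSplit x
pairSplit-suc {x} 1<x = record
  { a         = suc x
  ; b         = x * suc x
  ; x<a       = n<1+n x
  ; a<b       = subst (suc x <_) (*-comm (suc x) x) (m<m*n (suc x) x 1<x)
  ; recip-sum = recip+recip≡recip {suc x} {x * suc x} {x} z<s 1≤b 1≤x (identity x)
  }
  where
  1≤x : 1 ≤ x
  1≤x = <⇒≤ 1<x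
  1≤b : 1 ≤ x * suc x
  1≤b = ≤-trans 1≤x (m≤m*n x (suc x))
  identity : ∀ x → x * (suc x + x * suc x) ≡ suc x * (x * suc x)
  identity = solve-∀

pairSplit-composite : ∀ {x} → Composite x →
  Σ[ s ∈ PairSplit x ] suc x < PairSplit.a s × PairSplit.b s < x * suc x
pairSplit-composite (hasNonTrivialDivisor () (divides zero refl))
pairSplit-composite (hasNonTrivialDivisor {d} d<x (divides (suc c) refl)) = record
  { a         = x + d
  ; b         = x + x * suc c
  ; x<a       = m<m+n x 0<d
  ; a<b       = +-monoʳ-< x (<-≤-trans d<x (m≤m*n x (suc c)))
  ; recip-sum = recip+recip≡recip (≤-trans 0<x (m≤m+n x d)) (≤-trans 0<x (m≤m+n x (x * suc c))) 0<x
                  (identity (suc c) d)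
  } , subst (_< x + d) (+-comm x 1) (+-monoʳ-< x 1<d)
    , subst (x + x * suc c <_) (sym (*-suc x x)) (+-monoʳ-< x (*-monoʳ-< x {{x≢0}} c<x))
  where
  x : ℕ
  x = suc c * d
  1<d : 1 < d
  1<d = nonTrivial⇒n>1 d
  0<d : 0 < d
  0<d = <-trans z<s 1<d
  0<x : 0 < x
  0<x = <-trans 0<d d<x
  x≢0 : NonZero x
  x≢0 = >-nonZero 0<x
  c<x : suc c < x
  c<x = m<m*n (suc c) d 1<d
  identity : ∀ c d → (c * d) * ((c * d + d) + (c * d + c * d * c)) ≡ (c * d + d) * (c * d + c * d * c)
  identity = solve-∀

insert-sorted : ∀ {ℓ y a b} → ℓ ≤ y → ℓ ≤ a → a < b → y ≢ a → y ≢ b →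
  ∃[ t ] StrictlyIncreasing t × ℓ ≤ head t × y ∈ t × sumRecip t ≡ recip y +ℚ (recip a +ℚ recip b)
insert-sorted {y = y} {a} {b} ℓ≤y ℓ≤a a<b y≢a y≢b with <-cmp y a | <-cmp y b
... | tri< y<a _ _ | _ =
  y ∷ a ∷ b ∷ [] , ∷-inc y<a (∷-inc a<b [-]-inc) , ℓ≤y , here refl ,
  sumRecip-triple y a b
... | tri> _ _ a<y | tri< y<b _ _ =
  a ∷ y ∷ b ∷ [] , ∷-inc a<y (∷-inc y<b [-]-inc) , ℓ≤a , there (here refl) ,
  trans (sumRecip-triple a y b) (x∙yz≈y∙xz (recip a) (recip y) (recip b))
... | tri> _ _ a<y | tri> _ _ b<y =
  a ∷ b ∷ y ∷ [] , ∷-inc a<b (∷-inc b<y [-]-inc) , ℓ≤a , there (there (here refl)) ,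
  trans (sumRecip-triple a b y) (x∙yz≈z∙xy (recip a) (recip b) (recip y))
... | tri≈ _ y≡a _ | _            = contradiction y≡a y≢a
... | tri> _ _ _   | tri≈ _ y≡b _ = contradiction y≡b y≢b

record Refinement (x N m : ℕ) : Set where
  field
    parts      : Vec ℕ 3
    increasing : StrictlyIncreasing parts
    x≤head     : x ≤ head parts
    sum≡       : sumRecip parts ≡ recip x +ℚ recip N
    keeps      : m ∈ x ∷ N ∷ [] → m ∈ parts

refine : ∀ {n x N m} (u : Vec ℕ n) → InS _ (u ++ x ∷ N ∷ []) → m ∈ u ++ x ∷ N ∷ [] →
         Refinement x N m → InD (n + 3) m
refine {x = x} {N} u (fp , inc , sum≡1) m∈v r =
  u ++ parts ,
  ( firstPositive-++-replace u fp x≤head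
  , increasing-++-replace u inc increasing x≤head
  , trans (sumRecip-++-cong u (trans sum≡ (sym (sumRecip-pair x N)))) sum≡1 ) ,
  [ Any.++⁺ˡ , Any.++⁺ʳ u ∘ keeps ]′ (Any.++⁻ u m∈v)
  where open Refinement r

refinement-splitting-last : ∀ {x N m} → x < N → m ≢ N → PairSplit N → Refinement x N m
refinement-splitting-last {x} {N} x<N m≢N s =
  let t , inc , x≤t , x∈t , sum≡ = insert-sorted ≤-refl (<⇒≤ x<a) a<b (<⇒≢ x<a) (<⇒≢ (<-trans x<a a<b))
  in record
  { parts      = t
  ; increasing = inc
  ; x≤head     = x≤t
  ; sum≡       = trans sum≡ (cong (recip x +ℚ_) recip-sum)
  ; keeps      = λ { (here refl) → x∈t ; (there (here m≡N)) → contradiction m≡N m≢N }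
  }
  where
  open PairSplit s renaming (x<a to N<a)
  x<a : x < a
  x<a = <-trans x<N N<a

refinement-splitting-first : ∀ {x N} → x < N → (s : PairSplit x) →
  N ≢ PairSplit.a s → N ≢ PairSplit.b s → Refinement x N N
refinement-splitting-first {x} {N} x<N s N≢a N≢b =
  let t , inc , x≤t , N∈t , sum≡ = insert-sorted (<⇒≤ x<N) (<⇒≤ x<a) a<b N≢a N≢b
  in record
  { parts      = t
  ; increasing = inc
  ; x≤head     = x≤t
  ; sum≡       = trans sum≡ (trans (cong (recip N +ℚ_) recip-sum) (+ℚ-comm (recip N) (recip x)))
  ; keeps      = const N∈t
  }
  where open PairSplit s

endpoint≢interior : ∀ {lo a b hi N} → lo < a → a < b → b < hi → N ≡ lo ⊎ N ≡ hi → N ≢ a × N ≢ b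
endpoint≢interior lo<a a<b _    (inj₁ refl) = <⇒≢ lo<a , <⇒≢ (<-trans lo<a a<b)
endpoint≢interior _    a<b b<hi (inj₂ refl) = >⇒≢ (<-trans a<b b<hi) , >⇒≢ b<hi

refinement-keeping-last-exceptional : ∀ {n x N} (u : Vec ℕ n) → InS _ (u ++ x ∷ N ∷ []) → x < N → 1 < x →
  N ≡ suc x ⊎ N ≡ x * suc x → Refinement x N N
refinement-keeping-last-exceptional {x = x} u sol x<N 1<x N≡ with composite? x
... | no ¬composite-x =
  ⊥-elim (no-solution-ending-prime u (¬composite⇒prime {{n>1⇒nonTrivial 1<x}} ¬composite-x) N≡ sol)
... | yes composite-x with pairSplit-composite composite-x
...   | s , x+1<a , b<x[x+1] =
  let N≢a , N≢b = endpoint≢interior x+1<a (PairSplit.a<b s) b<x[x+1] N≡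
  in refinement-splitting-first x<N s N≢a N≢b

refinement-keeping-last : ∀ {n x N} (u : Vec ℕ n) → InS _ (u ++ x ∷ N ∷ []) → Refinement x N N
refinement-keeping-last {x = x} {N} u sol with lastTwo-bounds u sol | x ≟ 1
... | _ , 1<N | yes refl = ⊥-elim (obstructed u sol (obstruction-one 1<N))
... | 1≤x , x<N | no x≢1 with ≤∧≢⇒< 1≤x (x≢1 ∘ sym) | N ≟ suc x | N ≟ x * suc x
...   | 1<x | no N≢a    | no N≢b       = refinement-splitting-first x<N (pairSplit-suc 1<x) N≢a N≢b
...   | 1<x | yes N≡x+1 | _            = refinement-keeping-last-exceptional u sol x<N 1<x (inj₁ N≡x+1)
...   | 1<x | no _      | yes N≡x[x+1] = refinement-keeping-last-exceptional u sol x<N 1<x (inj₂ N≡x[x+1])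

-- Lengths are written n + 2 and n + 3 so that splitAt n exposes the last two entries.
InD-extend : ∀ n {m} → InD (n + 2) m → InD (n + 3) m
InD-extend n {m} (v , sol , m∈v) with splitAt n v
... | u , x ∷ N ∷ [] , refl with m ≟ N | lastTwo-bounds u sol
...   | yes refl | _         = refine u sol m∈v (refinement-keeping-last u sol)
...   | no m≢N   | 1≤x , x<N =
  refine u sol m∈v (refinement-splitting-last x<N m≢N (pairSplit-suc (≤-<-trans 1≤x x<N)))

lemma2p1 : ∀ (k : ℕ) → 2 ≤ k → ∀ (m : ℕ) → InD k m → InD (suc k) m
lemma2p1 (suc (suc n)) (s≤s (s≤s z≤n)) m sol =
  subst (λ k → InD k m) (+-comm n 3) (InD-extend n (subst (λ k → InD k m) (+-comm 2 n) sol))
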